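{- Let $(\mathcal{U},\mathcal{S})$ be a set system with $\bigcup_{s\in\mathcal{S}}s=\mathcal{U}$, $|\mathcal{U}|\le n$, every element in at most $f$ sets, and set costs $c_s\in(1/C,1)$ for some $C>1$. Let $\epsilon\in(0,0.1)$ and $L=\lceil\log_{1+\epsilon}(Cn)\rceil+1$. Suppose each set $s$ has a level $l(s)\in\{0,1,\dots,L\}$ and a dead weight $\phi(s)\ge0$; each element $e$ has level $l(e)=\max_{s\ni e}l(s)$ and weight $w(e)=(1+\epsilon)^{ -l(e)}$; $w(s)=\sum_{e\in s}w(e)$, and for an integer $i\ge0$, $w(s,i)=\sum_{e\in s}(1+\epsilon)^{ -\max\{i,\max_{s'\ne s:e\in s'}l(s')\}}$ (with the inner maximum taken as $0$ if no other set contains $e$). Call $s$ tight if $w(s)+\phi(s)>c_s/(1+\epsilon)$, and let $T$ be the collection of tight sets, $c(T)=\sum_{s\in T}c_s$, $\Phi=\sum_{s\in\mathcal{S}}\phi(s)$. Assume: (1) $w(s,l(s)+1)<c_s$ for all $s$; (2) every set with $l(s)\ge1$ is tight; (3) if $w(s)+\phi(s)>c_s$ then $\phi(s)=0$; (4) $\Phi\le\epsilon\,(c(T)+f\cdot w(\mathcal{U}))$ where $w(\mathcal{U})=\sum_{e\in\mathcal{U}}w(e)$. Then $T$ is a set cover of $\mathcal{U}$ with $c(T)\le(1+5\epsilon)f\cdot\mathsf{OPT}$, where $\mathsf{OPT}$ is the minimum cost of a set cover.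
   Context: A set cover is a subcollection $\mathcal{S}'\subseteq\mathcal{S}$ with $\bigcup_{s\in\mathcal{S}'}s=\mathcal{U}$; its cost is $\sum_{s\in\mathcal{S}'}c_s$.
   Formalization: The set costs $c_s$, the dead weights $\phi(s)$ and the parameters $C$ and $\epsilon$ are rational numbers. -}

module Defs where

open import Data.Bool using (Bool; true; false; if_then_else_; _∧_; not)
open import Data.Nat as ℕ using (ℕ; zero; suc; _⊔_)
open import Data.Fin using (Fin; zero; suc; _≟_)
open import Data.Fin.Subset using (Subset)
open import Data.Vec using (lookup)
open import Data.Integer using (+_)
open import Data.Rational using (ℚ; 0ℚ; 1ℚ; _+_; _*_; _<_; 1/_; >-nonZero)
open import Data.Rational.Properties using (_<?_; +-mono-<; <-trans)
open import Data.Unit using (tt)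
open import Relation.Nullary.Decidable using (toWitness)
open import Data.Product using (∃; _×_)
open import Data.Fin.Subset using (_∈_)
open import Relation.Nullary.Decidable using (⌊_⌋)
open import Relation.Binary.PropositionalEquality using (subst)

ℕ→ℚ : ℕ → ℚ
ℕ→ℚ n = Data.Rational._/_ (+ n) 1

sumFin : (n : ℕ) → (Fin n → ℚ) → ℚ
sumFin zero    g = 0ℚ
sumFin (suc n) g = g zero + sumFin n (λ i → g (suc i))

pow : ℚ → ℕ → ℚ
pow q zero    = 1ℚ
pow q (suc k) = q * pow q k

inv : (q : ℚ) → .(0ℚ < q) → ℚ
inv q p = 1/_ q {{>-nonZero p}}

maxOver : (m : ℕ) → (Fin m → Bool) → (Fin m → ℕ) → ℕ
maxOver zero    P lvl = 0
maxOver (suc m) P lvl =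
  (if P zero then lvl zero else 0) ⊔ maxOver m (λ i → P (suc i)) (λ i → lvl (suc i))

0<1 : 0ℚ < 1ℚ
0<1 = toWitness {a? = 0ℚ <? 1ℚ} tt

0<1+ : {ε : ℚ} → 0ℚ < ε → 0ℚ < 1ℚ + ε
0<1+ ε>0 = +-mono-< 0<1 ε>0

0<of1< : {C : ℚ} → 1ℚ < C → 0ℚ < C
0<of1< 1<C = <-trans 0<1 1<C

_∋?_ : {u : ℕ} → Subset u → Fin u → Bool
s ∋? e = lookup s e

module Weights (u m : ℕ) (S : Fin m → Subset u) (ε : ℚ) (1+ε>0 : 0ℚ < 1ℚ + ε)
               (lvl : Fin m → ℕ) (c φ : Fin m → ℚ) where

  β : ℚ
  β = inv (1ℚ + ε) 1+ε>0

  elemLevel : Fin u → ℕ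
  elemLevel e = maxOver m (λ s → S s ∋? e) lvl

  wElem : Fin u → ℚ
  wElem e = pow β (elemLevel e)

  wSet : Fin m → ℚ
  wSet s = sumFin u (λ e → if S s ∋? e then wElem e else 0ℚ)

  wSetAt : Fin m → ℕ → ℚ
  wSetAt s i = sumFin u (λ e → if S s ∋? e
    then pow β (i ⊔ maxOver m (λ s' → not ⌊ s' ≟ s ⌋ ∧ (S s' ∋? e)) lvl)
    else 0ℚ)

  wU : ℚ
  wU = sumFin u wElem

  Tight : Fin m → Set
  Tight s = c s * β < wSet s + φ s

  tight? : Fin m → Bool
  tight? s = ⌊ c s * β <? wSet s + φ s ⌋

  cT : ℚ
  cT = sumFin m (λ s → if tight? s then c s else 0ℚ)

  Φ : ℚ
  Φ = sumFin m φ

IsCover : {u m : ℕ} → (Fin m → Subset u) → Subset m → Set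
IsCover {u} {m} S S' = (e : Fin u) → ∃ λ s → s ∈ S' × e ∈ S s

cost : {m : ℕ} → (Fin m → ℚ) → Subset m → ℚ
cost {m} c S' = sumFin m (λ s → if S' ∋? s then c s else 0ℚ)

module Submission where

-- Every element e lies in a set s whose level is the level of e. That set is tight: by (2) if
-- the level is positive, and otherwise because then w(e) = 1 > c_s. Raising the level of s by
-- one changes each weight by a factor at most 1 + ε, so (1) gives w(s) ≤ (1 + ε) c_s, and
-- charging each element to a set of a cover S′ gives w(U) ≤ (1 + ε) c(S′). A tight set has
-- c_s < (1 + ε)(w(s) + φ(s)) and each element lies in at most f sets, so
-- c(T) ≤ (1 + ε)(f w(U) + Φ); with (4) this is a linear inequality for c(T) whose solution is
-- at most (1 + 5ε) f c(S′) as long as ε < 1/10.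

open import Defs
open import Data.Bool using (Bool; true; false; if_then_else_; _∧_; not)
open import Data.Nat as ℕ using (ℕ; zero; suc; _⊔_; z≤n; s≤s)
import Data.Nat.Properties as ℕ
open import Data.Fin using (Fin; zero; suc)
open import Data.Fin.Subset using (Subset; _∈_; ∣_∣)
open import Data.Vec using (tabulate; lookup)
open import Data.Vec.Properties using ([]=⇒lookup; lookup⇒[]=)
import Data.Integer as ℤ
import Data.Integer.Properties as ℤ
open import Data.Rational
  using (ℚ; 0ℚ; 1ℚ; _+_; _*_; _<_; _≤_; _/_; _-_; -_; mkℚ; *≤*; >-nonZero; positive; nonNegative)
open import Data.Rational.Properties
import Data.Rational.Solver as ℚ-Solver
import Data.Nat.Coprimality as Coprimality
open import Data.Product using (∃; _×_; _,_; proj₁; proj₂)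
open import Data.Sum using (_⊎_; inj₁; inj₂)
open import Relation.Nullary using (yes; no)
open import Relation.Nullary.Decidable using (⌊_⌋)
open import Relation.Binary.PropositionalEquality

ℕ→ℚ≡mkℚ : ∀ n → ℕ→ℚ n ≡ mkℚ (ℤ.+ n) 0 (Coprimality.sym (Coprimality.1-coprimeTo n))
ℕ→ℚ≡mkℚ n = ↥p/↧p≡p (mkℚ (ℤ.+ n) 0 _)

ℕ→ℚ-suc : ∀ n → ℕ→ℚ (suc n) ≡ 1ℚ + ℕ→ℚ n
ℕ→ℚ-suc n rewrite ℕ→ℚ≡mkℚ n = sym (cong (λ z → (ℤ.+ 1 ℤ.+ z) / 1) (ℤ.*-identityʳ (ℤ.+ n)))

ℕ→ℚ-mono-≤ : ∀ {a b} → a ℕ.≤ b → ℕ→ℚ a ≤ ℕ→ℚ b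
ℕ→ℚ-mono-≤ {a} {b} a≤b rewrite ℕ→ℚ≡mkℚ a | ℕ→ℚ≡mkℚ b =
  *≤* (subst₂ ℤ._≤_ (sym (ℤ.*-identityʳ (ℤ.+ a))) (sym (ℤ.*-identityʳ (ℤ.+ b))) (ℤ.+≤+ a≤b))

ℕ→ℚ-nonNeg : ∀ n → 0ℚ ≤ ℕ→ℚ n
ℕ→ℚ-nonNeg n = ℕ→ℚ-mono-≤ {0} {n} z≤n

p≤p+q : ∀ p {q} → 0ℚ ≤ q → p ≤ p + q
p≤p+q p {q} 0≤q = subst (_≤ p + q) (+-identityʳ p) (+-monoʳ-≤ p 0≤q)

p≤q+p : ∀ {q} p → 0ℚ ≤ q → p ≤ q + p
p≤q+p {q} p 0≤q = subst (_≤ q + p) (+-identityˡ p) (+-monoˡ-≤ p 0≤q)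

+-nonNeg : ∀ {p q} → 0ℚ ≤ p → 0ℚ ≤ q → 0ℚ ≤ p + q
+-nonNeg {p} 0≤p 0≤q = ≤-trans 0≤p (p≤p+q p 0≤q)

*-nonNeg : ∀ {p q} → 0ℚ ≤ p → 0ℚ ≤ q → 0ℚ ≤ p * q
*-nonNeg {p} {q} 0≤p 0≤q =
  nonNegative⁻¹ (p * q) {{nonNeg*nonNeg⇒nonNeg p {{nonNegative 0≤p}} q {{nonNegative 0≤q}}}}

*-monoˡ-≤-0≤ : ∀ {r p q} → 0ℚ ≤ r → p ≤ q → r * p ≤ r * q
*-monoˡ-≤-0≤ {r} 0≤r = *-monoˡ-≤-nonNeg r {{nonNegative 0≤r}}

p≤q⇒0≤q-p : ∀ {p q} → p ≤ q → 0ℚ ≤ q - p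
p≤q⇒0≤q-p {p} {q} p≤q = subst (_≤ q - p) (+-inverseʳ p) (+-monoˡ-≤ (- p) p≤q)

sumFin-cong : ∀ n {g h : Fin n → ℚ} → (∀ i → g i ≡ h i) → sumFin n g ≡ sumFin n h
sumFin-cong zero    g≡h = refl
sumFin-cong (suc n) g≡h = cong₂ _+_ (g≡h zero) (sumFin-cong n (λ i → g≡h (suc i)))

sumFin-mono-≤ : ∀ n {g h : Fin n → ℚ} → (∀ i → g i ≤ h i) → sumFin n g ≤ sumFin n h
sumFin-mono-≤ zero    g≤h = ≤-refl
sumFin-mono-≤ (suc n) g≤h = +-mono-≤ (g≤h zero) (sumFin-mono-≤ n (λ i → g≤h (suc i)))

sumFin-zero : ∀ n → sumFin n (λ _ → 0ℚ) ≡ 0ℚ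
sumFin-zero zero    = refl
sumFin-zero (suc n) = trans (+-identityˡ _) (sumFin-zero n)

sumFin-nonNeg : ∀ n {g : Fin n → ℚ} → (∀ i → 0ℚ ≤ g i) → 0ℚ ≤ sumFin n g
sumFin-nonNeg n {g} 0≤g = subst (_≤ sumFin n g) (sumFin-zero n) (sumFin-mono-≤ n 0≤g)

sumFin-+ : ∀ n (g h : Fin n → ℚ) → sumFin n (λ i → g i + h i) ≡ sumFin n g + sumFin n h
sumFin-+ zero    g h = refl
sumFin-+ (suc n) g h =
  trans (cong ((g zero + h zero) +_) (sumFin-+ n (λ i → g (suc i)) (λ i → h (suc i))))
        (interchange (g zero) (h zero) _ _)
  where
  open ℚ-Solver.+-*-Solver
  interchange : ∀ a b c d → (a + b) + (c + d) ≡ (a + c) + (b + d)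
  interchange = solve 4 (λ a b c d → (a :+ b) :+ (c :+ d) := (a :+ c) :+ (b :+ d)) refl

sumFin-*ˡ : ∀ n k (g : Fin n → ℚ) → sumFin n (λ i → k * g i) ≡ k * sumFin n g
sumFin-*ˡ zero    k g = sym (*-zeroʳ k)
sumFin-*ˡ (suc n) k g =
  trans (cong (k * g zero +_) (sumFin-*ˡ n k (λ i → g (suc i))))
        (sym (*-distribˡ-+ k (g zero) _))

sumFin-comm : ∀ u m (g : Fin u → Fin m → ℚ) →
  sumFin u (λ e → sumFin m (g e)) ≡ sumFin m (λ s → sumFin u (λ e → g e s))
sumFin-comm zero    m g = sym (sumFin-zero m)
sumFin-comm (suc u) m g =
  trans (cong (sumFin m (g zero) +_) (sumFin-comm u m (λ e → g (suc e))))
        (sym (sumFin-+ m (g zero) (λ s → sumFin u (λ e → g (suc e) s))))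

term≤sumFin : ∀ n {g : Fin n → ℚ} → (∀ i → 0ℚ ≤ g i) → (j : Fin n) → g j ≤ sumFin n g
term≤sumFin (suc n) 0≤g zero    = p≤p+q _ (sumFin-nonNeg n (λ i → 0≤g (suc i)))
term≤sumFin (suc n) 0≤g (suc j) =
  ≤-trans (term≤sumFin n (λ i → 0≤g (suc i)) j) (p≤q+p _ (0≤g zero))

if-nonNeg : ∀ (b : Bool) {x} → 0ℚ ≤ x → 0ℚ ≤ (if b then x else 0ℚ)
if-nonNeg true  0≤x = 0≤x
if-nonNeg false 0≤x = ≤-refl

if≤ : ∀ (b : Bool) {x} → 0ℚ ≤ x → (if b then x else 0ℚ) ≤ x
if≤ true  0≤x = ≤-refl
if≤ false 0≤x = 0≤x

if-true : ∀ {b : Bool} {A : Set} {x y : A} → b ≡ true → (if b then x else y) ≡ x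
if-true refl = refl

if-scale-≤ : ∀ (b : Bool) {r x y} → 0ℚ ≤ r → (b ≡ true → x ≤ r * y) →
             (if b then x else 0ℚ) ≤ r * (if b then y else 0ℚ)
if-scale-≤ true  0≤r x≤ry = x≤ry refl
if-scale-≤ false 0≤r x≤ry = *-nonNeg 0≤r ≤-refl

sumFin-if : ∀ n (b : Bool) (g : Fin n → ℚ) →
  sumFin n (λ i → if b then g i else 0ℚ) ≡ (if b then sumFin n g else 0ℚ)
sumFin-if n true  g = refl
sumFin-if n false g = sumFin-zero n

sumFin-count : ∀ m (B : Fin m → Bool) x →
  sumFin m (λ s → if B s then x else 0ℚ) ≡ ℕ→ℚ ∣ tabulate B ∣ * x
sumFin-count zero    B x = sym (*-zeroˡ x)
sumFin-count (suc m) B x with B zero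
... | false = trans (+-identityˡ _) (sumFin-count m (λ i → B (suc i)) x)
... | true  = begin
  x + sumFin m (λ s → if B (suc s) then x else 0ℚ) ≡⟨ cong (x +_) (sumFin-count m (λ i → B (suc i)) x) ⟩
  x + ℕ→ℚ k * x                                    ≡⟨ cong (_+ ℕ→ℚ k * x) (sym (*-identityˡ x)) ⟩
  1ℚ * x + ℕ→ℚ k * x                               ≡⟨ sym (*-distribʳ-+ x 1ℚ (ℕ→ℚ k)) ⟩
  (1ℚ + ℕ→ℚ k) * x                                 ≡⟨ cong (_* x) (sym (ℕ→ℚ-suc k)) ⟩
  ℕ→ℚ (suc k) * x                                  ∎
  where
  open ≡-Reasoning
  k = ∣ tabulate (λ i → B (suc i)) ∣

≤maxOver : ∀ m P lvl (s : Fin m) → P s ≡ true → lvl s ℕ.≤ maxOver m P lvl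
≤maxOver (suc m) P lvl zero    Ps rewrite Ps = ℕ.m≤m⊔n _ _
≤maxOver (suc m) P lvl (suc s) Ps =
  ℕ.m≤n⇒m≤o⊔n _ (≤maxOver m (λ i → P (suc i)) (λ i → lvl (suc i)) s Ps)

maxOver-mono-⊆ : ∀ m P Q lvl → (∀ s → P s ≡ true → Q s ≡ true) →
                 maxOver m P lvl ℕ.≤ maxOver m Q lvl
maxOver-mono-⊆ zero    P Q lvl P⊆Q = z≤n
maxOver-mono-⊆ (suc m) P Q lvl P⊆Q =
  ℕ.⊔-mono-≤ (head (P zero) (Q zero) (P⊆Q zero))
             (maxOver-mono-⊆ m (λ i → P (suc i)) (λ i → Q (suc i)) (λ i → lvl (suc i)) (λ s → P⊆Q (suc s)))
  where
  head : ∀ a b → (a ≡ true → b ≡ true) → (if a then lvl zero else 0) ℕ.≤ (if b then lvl zero else 0)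
  head true  b a⇒b rewrite a⇒b refl = ℕ.≤-refl
  head false b a⇒b = z≤n

maxOver≡0⊎attained : ∀ m P lvl →
  maxOver m P lvl ≡ 0 ⊎ ∃ λ s → P s ≡ true × maxOver m P lvl ≡ lvl s
maxOver≡0⊎attained zero P lvl = inj₁ refl
maxOver≡0⊎attained (suc m) P lvl
  with P zero in P0 | maxOver≡0⊎attained m (λ i → P (suc i)) (λ i → lvl (suc i))
... | false | inj₁ max≡0         = inj₁ max≡0
... | false | inj₂ (s , Ps , eq) = inj₂ (suc s , Ps , eq)
... | true  | rest with ℕ.≤-total (maxOver m (λ i → P (suc i)) (λ i → lvl (suc i))) (lvl zero)
...   | inj₁ rest≤l0 = inj₂ (zero , P0 , ℕ.m≥n⇒m⊔n≡m rest≤l0)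
...   | inj₂ l0≤rest with rest
...     | inj₁ max≡0         = inj₁ (trans (ℕ.m≤n⇒m⊔n≡n l0≤rest) max≡0)
...     | inj₂ (s , Ps , eq) = inj₂ (suc s , Ps , trans (ℕ.m≤n⇒m⊔n≡n l0≤rest) eq)

maxOver-attained : ∀ m P lvl (s₀ : Fin m) → P s₀ ≡ true →
  ∃ λ s → P s ≡ true × maxOver m P lvl ≡ lvl s
maxOver-attained m P lvl s₀ Ps₀ with maxOver≡0⊎attained m P lvl
... | inj₂ attained = attained
... | inj₁ max≡0    =
  s₀ , Ps₀ , trans max≡0 (sym (ℕ.n≤0⇒n≡0 (subst (lvl s₀ ℕ.≤_) max≡0 (≤maxOver m P lvl s₀ Ps₀))))

pow-nonNeg : ∀ {q} → 0ℚ ≤ q → ∀ k → 0ℚ ≤ pow q k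
pow-nonNeg 0≤q zero    = <⇒≤ 0<1
pow-nonNeg 0≤q (suc k) = *-nonNeg 0≤q (pow-nonNeg 0≤q k)

pow≤1 : ∀ {q} → 0ℚ ≤ q → q ≤ 1ℚ → ∀ k → pow q k ≤ 1ℚ
pow≤1 0≤q q≤1 zero    = ≤-refl
pow≤1 {q} 0≤q q≤1 (suc k) =
  ≤-trans (*-monoˡ-≤-0≤ 0≤q (pow≤1 0≤q q≤1 k)) (subst (_≤ 1ℚ) (sym (*-identityʳ q)) q≤1)

pow-antimono-≤ : ∀ {q} → 0ℚ ≤ q → q ≤ 1ℚ → ∀ {a b} → a ℕ.≤ b → pow q b ≤ pow q a
pow-antimono-≤ 0≤q q≤1 {b = b} z≤n   = pow≤1 0≤q q≤1 b
pow-antimono-≤ 0≤q q≤1 (s≤s a≤b) = *-monoˡ-≤-0≤ 0≤q (pow-antimono-≤ 0≤q q≤1 a≤b)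

module _ {ε : ℚ} (0<ε : 0ℚ < ε) (ε<1/10 : ε < ℤ.+ 1 / 10) where
  open ℚ-Solver.+-*-Solver

  private
    0≤ε : 0ℚ ≤ ε
    0≤ε = <⇒≤ 0<ε

    δ : ℚ
    δ = 1ℚ - ℕ→ℚ 10 * ε

    0<δ : 0ℚ < δ
    0<δ = subst (_< δ) (+-inverseʳ (ℕ→ℚ 10 * ε))
                (+-monoˡ-< (- (ℕ→ℚ 10 * ε)) (*-monoʳ-<-pos (ℕ→ℚ 10) ε<1/10))

    0≤δ : 0ℚ ≤ δ
    0≤δ = <⇒≤ 0<δ

    γ : ℚ
    γ = 1ℚ - ε - ε * ε

    0<γ : 0ℚ < γ
    0<γ = subst (0ℚ <_) (sym γ≡)
            (<-≤-trans 0<δ (p≤p+q δ (*-nonNeg 0≤ε (+-nonNeg (+-nonNeg (ℕ→ℚ-nonNeg 8) 0≤δ)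
                                                             (*-nonNeg (ℕ→ℚ-nonNeg 9) 0≤ε)))))
      where
      γ≡ : γ ≡ δ + ε * (ℕ→ℚ 8 + δ + ℕ→ℚ 9 * ε)
      γ≡ = solve 1 (λ e → con 1ℚ :- e :- e :* e :=
             (con 1ℚ :- con (ℕ→ℚ 10) :* e)
             :+ e :* (con (ℕ→ℚ 8) :+ (con 1ℚ :- con (ℕ→ℚ 10) :* e) :+ con (ℕ→ℚ 9) :* e)) refl ε

    0≤1-6ε : 0ℚ ≤ 1ℚ - ℕ→ℚ 6 * ε
    0≤1-6ε = subst (0ℚ ≤_) (sym (solve 1 (λ e → con 1ℚ :- con (ℕ→ℚ 6) :* e :=
                                    (con 1ℚ :- con (ℕ→ℚ 10) :* e) :+ con (ℕ→ℚ 4) :* e) refl ε))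
                   (+-nonNeg 0≤δ (*-nonNeg (ℕ→ℚ-nonNeg 4) 0≤ε))

    0≤1+ε : 0ℚ ≤ 1ℚ + ε
    0≤1+ε = +-nonNeg (<⇒≤ 0<1) 0≤ε

    -- With γ = 1 − ε − ε², γ·((1 + 5ε)FK − x) is a nonnegative combination of the slacks of the
    -- four hypotheses of charging-bound and of ε(1 − 10ε)FK and ε²(1 − 6ε)FK.
    certificate : ∀ x Y P W K F →
      γ * ((1ℚ + ℕ→ℚ 5 * ε) * F * K - x) ≡
        (((1ℚ + ε) * (Y + P) - x) + (1ℚ + ε) * (F * W - Y))
        + (1ℚ + ε) * (ε * (x + F * W) - P)
        + (1ℚ + ε) * (1ℚ + ε) * F * ((1ℚ + ε) * K - W)
        + ε * δ * F * K + ε * ε * (1ℚ - ℕ→ℚ 6 * ε) * F * K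
    certificate = solve 7 (λ e x Y P W K F →
      (con 1ℚ :- e :- e :* e) :* ((con 1ℚ :+ con (ℕ→ℚ 5) :* e) :* F :* K :- x) :=
        (((con 1ℚ :+ e) :* (Y :+ P) :- x) :+ (con 1ℚ :+ e) :* (F :* W :- Y))
        :+ (con 1ℚ :+ e) :* (e :* (x :+ F :* W) :- P)
        :+ (con 1ℚ :+ e) :* (con 1ℚ :+ e) :* F :* ((con 1ℚ :+ e) :* K :- W)
        :+ e :* (con 1ℚ :- con (ℕ→ℚ 10) :* e) :* F :* K
        :+ e :* e :* (con 1ℚ :- con (ℕ→ℚ 6) :* e) :* F :* K) refl ε

  charging-bound : ∀ {x Y P W K F} → 0ℚ ≤ F → 0ℚ ≤ K →
    x ≤ (1ℚ + ε) * (Y + P) → Y ≤ F * W → P ≤ ε * (x + F * W) → W ≤ (1ℚ + ε) * K →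
    x ≤ (1ℚ + ℕ→ℚ 5 * ε) * F * K
  charging-bound {x} {Y} {P} {W} {K} {F} 0≤F 0≤K x≤ Y≤ P≤ W≤ =
    subst₂ _≤_ (+-identityˡ x) (minus-plus bound x) (+-monoˡ-≤ x 0≤bound-x)
    where
    bound : ℚ
    bound = (1ℚ + ℕ→ℚ 5 * ε) * F * K
    minus-plus : ∀ a b → (a - b) + b ≡ a
    minus-plus = solve 2 (λ a b → (a :- b) :+ b := a) refl
    0≤γ*[bound-x] : 0ℚ ≤ γ * (bound - x)
    0≤γ*[bound-x] = subst (0ℚ ≤_) (sym (certificate x Y P W K F))
      (+-nonNeg (+-nonNeg (+-nonNeg (+-nonNeg (+-nonNeg (p≤q⇒0≤q-p x≤) (*-nonNeg 0≤1+ε (p≤q⇒0≤q-p Y≤)))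
                                              (*-nonNeg 0≤1+ε (p≤q⇒0≤q-p P≤)))
                                    (*-nonNeg (*-nonNeg (*-nonNeg 0≤1+ε 0≤1+ε) 0≤F) (p≤q⇒0≤q-p W≤)))
                          (*-nonNeg (*-nonNeg (*-nonNeg 0≤ε 0≤δ) 0≤F) 0≤K))
                (*-nonNeg (*-nonNeg (*-nonNeg (*-nonNeg 0≤ε 0≤ε) 0≤1-6ε) 0≤F) 0≤K))
    0≤bound-x : 0ℚ ≤ bound - x
    0≤bound-x = *-cancelˡ-≤-pos γ {{positive 0<γ}} (subst (_≤ γ * (bound - x)) (sym (*-zeroʳ γ)) 0≤γ*[bound-x])

module Bounds (u m : ℕ) (S : Fin m → Subset u) {ε : ℚ} (0<ε : 0ℚ < ε)
  (lvl : Fin m → ℕ) (c φ : Fin m → ℚ)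
  (0≤c : ∀ s → 0ℚ ≤ c s) (c<1 : ∀ s → c s < 1ℚ) (0≤φ : ∀ s → 0ℚ ≤ φ s) where
  open Weights u m S ε (0<1+ 0<ε) lvl c φ

  private
    0≤1+ε : 0ℚ ≤ 1ℚ + ε
    0≤1+ε = <⇒≤ (0<1+ 0<ε)

    [1+ε]*β≡1 : (1ℚ + ε) * β ≡ 1ℚ
    [1+ε]*β≡1 = *-inverseʳ (1ℚ + ε) {{>-nonZero (0<1+ 0<ε)}}

    0≤β : 0ℚ ≤ β
    0≤β = <⇒≤ (positive⁻¹ β {{1/pos⇒pos (1ℚ + ε) {{positive (0<1+ 0<ε)}}}})

    β≤1 : β ≤ 1ℚ
    β≤1 = subst₂ _≤_ (*-identityʳ β) (trans (*-comm β (1ℚ + ε)) [1+ε]*β≡1)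
                 (*-monoˡ-≤-0≤ 0≤β (p≤p+q 1ℚ (<⇒≤ 0<ε)))

    0≤wElem : ∀ e → 0ℚ ≤ wElem e
    0≤wElem e = pow-nonNeg 0≤β (elemLevel e)

    0≤wSet : ∀ s → 0ℚ ≤ wSet s
    0≤wSet s = sumFin-nonNeg u (λ e → if-nonNeg (S s ∋? e) (0≤wElem e))

  wElem≤wSet : ∀ {e s} → e ∈ S s → wElem e ≤ wSet s
  wElem≤wSet {e} {s} e∈s =
    subst (_≤ wSet s) (if-true ([]=⇒lookup e∈s))
          (term≤sumFin u (λ e′ → if-nonNeg (S s ∋? e′) (0≤wElem e′)) e)

  level-0-tight : ∀ {e s} → e ∈ S s → elemLevel e ≡ 0 → Tight s
  level-0-tight {e} {s} e∈s l[e]≡0 = begin-strict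
    c s * β       ≤⟨ subst (c s * β ≤_) (*-identityʳ (c s)) (*-monoˡ-≤-0≤ (0≤c s) β≤1) ⟩
    c s           <⟨ c<1 s ⟩
    1ℚ            ≡⟨ cong (pow β) (sym l[e]≡0) ⟩
    wElem e       ≤⟨ wElem≤wSet e∈s ⟩
    wSet s        ≤⟨ p≤p+q (wSet s) (0≤φ s) ⟩
    wSet s + φ s  ∎
    where open ≤-Reasoning

  tight-cover : (∀ s → 1 ℕ.≤ lvl s → Tight s) → (∀ e → ∃ λ s → e ∈ S s) →
                ∀ e → ∃ λ s → Tight s × e ∈ S s
  tight-cover positive-tight cover e with cover e
  ... | s₀ , e∈s₀ with maxOver-attained m (λ s → S s ∋? e) lvl s₀ ([]=⇒lookup e∈s₀)
  ...   | s , e∈ˡs , l[e]≡l[s] = s , tight (lvl s) refl , e∈s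
    where
    e∈s : e ∈ S s
    e∈s = lookup⇒[]= e (S s) e∈ˡs
    tight : ∀ l → lvl s ≡ l → Tight s
    tight zero    l[s]≡0 = level-0-tight e∈s (trans l[e]≡l[s] l[s]≡0)
    tight (suc l) l[s]≡1+l = positive-tight s (subst (1 ℕ.≤_) (sym l[s]≡1+l) (s≤s z≤n))

  pow-β≤[1+ε]*pow-β : ∀ {a b} → b ℕ.≤ suc a → pow β a ≤ (1ℚ + ε) * pow β b
  pow-β≤[1+ε]*pow-β {a} {b} b≤1+a =
    subst (_≤ (1ℚ + ε) * pow β b) [1+ε]*β^[1+a]≡β^a
          (*-monoˡ-≤-0≤ 0≤1+ε (pow-antimono-≤ 0≤β β≤1 b≤1+a))
    where
    open ≡-Reasoning
    [1+ε]*β^[1+a]≡β^a : (1ℚ + ε) * pow β (suc a) ≡ pow β a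
    [1+ε]*β^[1+a]≡β^a = begin
      (1ℚ + ε) * (β * pow β a)  ≡⟨ sym (*-assoc (1ℚ + ε) β (pow β a)) ⟩
      (1ℚ + ε) * β * pow β a    ≡⟨ cong (_* pow β a) [1+ε]*β≡1 ⟩
      1ℚ * pow β a              ≡⟨ *-identityˡ (pow β a) ⟩
      pow β a                   ∎

  raised-level≤1+elemLevel : ∀ {e s} → (S s ∋? e) ≡ true →
    suc (lvl s) ⊔ maxOver m (λ s′ → not ⌊ s′ Data.Fin.≟ s ⌋ ∧ (S s′ ∋? e)) lvl ℕ.≤ suc (elemLevel e)
  raised-level≤1+elemLevel {e} {s} e∈s =
    ℕ.⊔-lub (s≤s (≤maxOver m (λ s′ → S s′ ∋? e) lvl s e∈s))
            (ℕ.≤-trans (maxOver-mono-⊆ m _ (λ s′ → S s′ ∋? e) lvl (λ s′ → ∧-true _))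
                       (ℕ.n≤1+n _))
    where
    ∧-true : ∀ a {b} → a ∧ b ≡ true → b ≡ true
    ∧-true true b≡true = b≡true

  wSet≤[1+ε]*wSetAt : ∀ s → wSet s ≤ (1ℚ + ε) * wSetAt s (suc (lvl s))
  wSet≤[1+ε]*wSetAt s = ≤-trans
    (sumFin-mono-≤ u (λ e → if-scale-≤ (S s ∋? e) 0≤1+ε
                              (λ e∈s → pow-β≤[1+ε]*pow-β (raised-level≤1+elemLevel e∈s))))
    (≤-reflexive (sumFin-*ˡ u (1ℚ + ε) _))

  module _ (wSetAt<c : ∀ s → wSetAt s (suc (lvl s)) < c s) where

    wSet≤[1+ε]*c : ∀ s → wSet s ≤ (1ℚ + ε) * c s
    wSet≤[1+ε]*c s = ≤-trans (wSet≤[1+ε]*wSetAt s) (*-monoˡ-≤-0≤ 0≤1+ε (<⇒≤ (wSetAt<c s)))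

    wU≤[1+ε]*cost : ∀ S′ → IsCover S S′ → wU ≤ (1ℚ + ε) * cost c S′
    wU≤[1+ε]*cost S′ cover = begin
      wU                                                ≤⟨ sumFin-mono-≤ u wElem≤covering ⟩
      sumFin u (λ e → sumFin m (covering e))            ≡⟨ sumFin-comm u m covering ⟩
      sumFin m (λ s → sumFin u (λ e → covering e s))    ≡⟨ sumFin-cong m (λ s → sumFin-if u (S′ ∋? s) _) ⟩
      sumFin m (λ s → if S′ ∋? s then wSet s else 0ℚ)   ≤⟨ sumFin-mono-≤ m (λ s →
                                                             if-scale-≤ (S′ ∋? s) 0≤1+ε (λ _ → wSet≤[1+ε]*c s)) ⟩
      sumFin m (λ s → (1ℚ + ε) * (if S′ ∋? s then c s else 0ℚ)) ≡⟨ sumFin-*ˡ m (1ℚ + ε) _ ⟩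
      (1ℚ + ε) * cost c S′                              ∎
      where
      open ≤-Reasoning
      covering : Fin u → Fin m → ℚ
      covering e s = if S′ ∋? s then (if S s ∋? e then wElem e else 0ℚ) else 0ℚ
      wElem≤covering : ∀ e → wElem e ≤ sumFin m (covering e)
      wElem≤covering e with cover e
      ... | s , s∈S′ , e∈s =
        subst (_≤ sumFin m (covering e)) (trans (if-true ([]=⇒lookup s∈S′)) (if-true ([]=⇒lookup e∈s)))
              (term≤sumFin m (λ s → if-nonNeg (S′ ∋? s) (if-nonNeg (S s ∋? e) (0≤wElem e))) s)

  wTight : ℚ
  wTight = sumFin m (λ s → if tight? s then wSet s else 0ℚ)

  wTight≤f*wU : ∀ f → (∀ e → ∣ tabulate (λ s → lookup (S s) e) ∣ ℕ.≤ f) → wTight ≤ ℕ→ℚ f * wU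
  wTight≤f*wU f frequency≤f = begin
    wTight                                                           ≤⟨ sumFin-mono-≤ m (λ s → if≤ (tight? s) (0≤wSet s)) ⟩
    sumFin m wSet                                                    ≡⟨ sym (sumFin-comm u m _) ⟩
    sumFin u (λ e → sumFin m (λ s → if S s ∋? e then wElem e else 0ℚ)) ≡⟨ sumFin-cong u (λ e → sumFin-count m (λ s → S s ∋? e) (wElem e)) ⟩
    sumFin u (λ e → ℕ→ℚ ∣ tabulate (λ s → S s ∋? e) ∣ * wElem e)    ≤⟨ sumFin-mono-≤ u (λ e →
                                                                          *-monoʳ-≤-nonNeg (wElem e) {{nonNegative (0≤wElem e)}}
                                                                            (ℕ→ℚ-mono-≤ (frequency≤f e))) ⟩
    sumFin u (λ e → ℕ→ℚ f * wElem e)                                 ≡⟨ sumFin-*ˡ u (ℕ→ℚ f) wElem ⟩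
    ℕ→ℚ f * wU                                                       ∎
    where open ≤-Reasoning

  tight-c≤[1+ε]*[wSet+φ] : ∀ s → Tight s → c s ≤ (1ℚ + ε) * (wSet s + φ s)
  tight-c≤[1+ε]*[wSet+φ] s tight =
    subst (_≤ (1ℚ + ε) * (wSet s + φ s)) [1+ε]*[c*β]≡c (*-monoˡ-≤-0≤ 0≤1+ε (<⇒≤ tight))
    where
    open ≡-Reasoning
    [1+ε]*[c*β]≡c : (1ℚ + ε) * (c s * β) ≡ c s
    [1+ε]*[c*β]≡c = begin
      (1ℚ + ε) * (c s * β)  ≡⟨ sym (*-assoc (1ℚ + ε) (c s) β) ⟩
      (1ℚ + ε) * c s * β    ≡⟨ cong (_* β) (*-comm (1ℚ + ε) (c s)) ⟩
      c s * (1ℚ + ε) * β    ≡⟨ *-assoc (c s) (1ℚ + ε) β ⟩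
      c s * ((1ℚ + ε) * β)  ≡⟨ cong (c s *_) [1+ε]*β≡1 ⟩
      c s * 1ℚ              ≡⟨ *-identityʳ (c s) ⟩
      c s                   ∎

  cT≤[1+ε]*[wTight+Φ] : cT ≤ (1ℚ + ε) * (wTight + Φ)
  cT≤[1+ε]*[wTight+Φ] = begin
    cT                                                                        ≤⟨ sumFin-mono-≤ m charge ⟩
    sumFin m (λ s → (1ℚ + ε) * ((if tight? s then wSet s else 0ℚ) + φ s))      ≡⟨ sumFin-*ˡ m (1ℚ + ε) _ ⟩
    (1ℚ + ε) * sumFin m (λ s → (if tight? s then wSet s else 0ℚ) + φ s)        ≡⟨ cong ((1ℚ + ε) *_) (sumFin-+ m _ φ) ⟩
    (1ℚ + ε) * (wTight + Φ)                                                   ∎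
    where
    open ≤-Reasoning
    charge : ∀ s → (if tight? s then c s else 0ℚ) ≤ (1ℚ + ε) * ((if tight? s then wSet s else 0ℚ) + φ s)
    charge s with c s * β <? wSet s + φ s
    ... | yes tight = tight-c≤[1+ε]*[wSet+φ] s tight
    ... | no _      = *-nonNeg 0≤1+ε (subst (0ℚ ≤_) (sym (+-identityˡ (φ s))) (0≤φ s))

  0≤cost : ∀ S′ → 0ℚ ≤ cost c S′
  0≤cost S′ = sumFin-nonNeg m (λ s → if-nonNeg (S′ ∋? s) (0≤c s))

lemmaB5 : (u m : ℕ) (S : Fin m → Subset u) →
    -- the sets cover the universe Fin u
    ((e : Fin u) → ∃ λ s → e ∈ S s) →
    (n : ℕ) → u ℕ.≤ n →
    (f : ℕ) → ((e : Fin u) → ∣ tabulate (λ s → lookup (S s) e) ∣ ℕ.≤ f) →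
    (C : ℚ) (hC : 1ℚ < C) (c : Fin m → ℚ) →
    ((s : Fin m) → inv C (0<of1< hC) < c s × c s < 1ℚ) →
    (ε : ℚ) (hε : 0ℚ < ε) → ε < (ℤ.+ 1 / 10) →
    -- L = ⌈log_{1+ε}(C n)⌉ + 1 = k + 2, where k < log_{1+ε}(C n) ≤ k + 1
    (k : ℕ) → pow (1ℚ + ε) k < C * ℕ→ℚ n → C * ℕ→ℚ n ≤ pow (1ℚ + ε) (suc k) →
    (L : ℕ) → L ≡ suc (suc k) →
    (lvl : Fin m → ℕ) → ((s : Fin m) → lvl s ℕ.≤ L) →
    (φ : Fin m → ℚ) → ((s : Fin m) → 0ℚ ≤ φ s) →
    let open Weights u m S ε (0<1+ hε) lvl c φ in
    -- (1)
    ((s : Fin m) → wSetAt s (suc (lvl s)) < c s) →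
    -- (2)
    ((s : Fin m) → 1 ℕ.≤ lvl s → Tight s) →
    -- (3)
    ((s : Fin m) → c s < wSet s + φ s → φ s ≡ 0ℚ) →
    -- (4)
    Φ ≤ ε * (cT + ℕ→ℚ f * wU) →
    -- conclusion: T is a set cover, and c(T) ≤ (1+5ε) f OPT
    ((e : Fin u) → ∃ λ s → Tight s × e ∈ S s)
    × ((S' : Subset m) → IsCover S S' →
         cT ≤ (1ℚ + ℕ→ℚ 5 * ε) * ℕ→ℚ f * cost c S')
lemmaB5 u m S cover _ _ f frequency≤f C 1<C c c-bounds ε 0<ε ε<1/10 _ _ _ _ _ lvl _ φ 0≤φ
        wSetAt<c positive-tight _ Φ≤ =
  B.tight-cover positive-tight cover ,
  λ S′ S′-covers →
    charging-bound 0<ε ε<1/10 (ℕ→ℚ-nonNeg f) (B.0≤cost S′)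
      B.cT≤[1+ε]*[wTight+Φ] (B.wTight≤f*wU f frequency≤f) Φ≤ (B.wU≤[1+ε]*cost wSetAt<c S′ S′-covers)
  where
  0<1/C : 0ℚ < inv C (0<of1< 1<C)
  0<1/C = positive⁻¹ _ {{1/pos⇒pos C {{positive (0<of1< 1<C)}}}}
  module B = Bounds u m S 0<ε lvl c φ (λ s → <⇒≤ (<-trans 0<1/C (proj₁ (c-bounds s))))
                    (λ s → proj₂ (c-bounds s)) 0≤φ
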